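{- Let $\Gamma\subseteq M_n(D)$ be a tiled order containing $\mathrm{diag}(\Delta,\dots,\Delta)$ with structural invariants $m_{ij\ell}$ and types of distinguished vertices $t_i$, and for $s\in\mathbb{Z}$ let $\Gamma_s=\xi_s\Gamma\xi_s^{ -1}$ with $\xi_s=\mathrm{diag}(\boldsymbol{\pi}^s,1,\dots,1)$. (1) If $\xi\in\mathcal{N}(\Gamma)$ is a monomial matrix, then $[(m_{ij\ell}),(t_1,\dots,t_n)]=[(m_{ij\ell}),(t_1+\ell\, t(\xi),\dots,t_n+\ell\,t(\xi))]$ for every $\ell\in\mathbb{Z}$. (2) If $\Gamma_i\sim\Gamma_{i+r}$ for some $i,r\in\mathbb{Z}$, then $\Gamma_i\sim\Gamma_{i+\ell r}$ for all $\ell\in\mathbb{Z}$.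
   Context: Setting: $k$ non-archimedean local field of characteristic $0$; $D$ central division algebra over $k$ with maximal order $\Delta$, prime element $\boldsymbol{\pi}$, $\mathfrak{p}=\boldsymbol{\pi}\Delta$. A tiled order containing $\mathrm{diag}(\Delta,\dots,\Delta)$ is $\Gamma=(\mathfrak{p}^{\mu_{ij}})$ with $\mu_{ij}\in\mathbb{Z}$, $\mu_{ii}=0$, $\mu_{ij}+\mu_{j\ell}\ge\mu_{i\ell}$. Structural invariants $m_{ij\ell}=\mu_{ij}+\mu_{j\ell}-\mu_{i\ell}$; types of distinguished vertices $t_j\equiv\sum_i\mu_{ij}\pmod n$. $\mathcal{N}(\Gamma)$ is the normalizer in $\mathrm{GL}_n(D)$. Type of a monomial matrix $(\boldsymbol{\pi}^{\alpha_i}\delta_{\tau(i)j})$: $\sum_i\alpha_i\bmod n$. $\Gamma\sim\Gamma'$ iff there is $\sigma\in S_n$ with $m'_{ij\ell}=m_{\sigma(i)\sigma(j)\sigma(\ell)}$ and $t'_i\equiv t_{\sigma(i)}\pmod n$; $[(m_{ij\ell}),(t_1,\dots,t_n)]$ denotes the $\sim$-class of any tiled order (containing the diagonal) with these invariants and types. -}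

module Defs where

open import Data.Nat using (ℕ; zero; suc)
open import Data.Fin using (Fin; zero; suc)
open import Data.Integer using (ℤ; +_; _+_; _-_; _*_; _≤_)
open import Data.Integer.Divisibility using (_∣_)
open import Data.Fin.Permutation using (Permutation′; _⟨$⟩ʳ_)
open import Data.Product using (Σ; _×_)
open import Relation.Binary.PropositionalEquality using (_≡_)

-- A tiled order Γ = (𝔭^{μ i j}) ⊆ M_n(D) containing diag(Δ,…,Δ) is determined
-- by its exponent matrix μ; we work with exponent matrices.
ExpMat : ℕ → Set
ExpMat n = Fin n → Fin n → ℤ

record IsTiled {n : ℕ} (μ : ExpMat n) : Set where
  field
    diag0 : ∀ i → μ i i ≡ + 0
    tri   : ∀ i j l → μ i l ≤ μ i j + μ j l

_≡[mod_]_ : ℤ → ℕ → ℤ → Set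
a ≡[mod n ] b = (+ n) ∣ (a - b)

sumℤ : ∀ {n} → (Fin n → ℤ) → ℤ
sumℤ {zero} f = + 0
sumℤ {suc n} f = f zero + sumℤ (λ i → f (suc i))

inv : ∀ {n} → ExpMat n → Fin n → Fin n → Fin n → ℤ
inv μ i j l = μ i j + μ j l - μ i l

-- types of distinguished vertices (integer representatives; meaningful mod n)
types : ∀ {n} → ExpMat n → Fin n → ℤ
types μ j = sumℤ (λ i → μ i j)

-- A monomial matrix ξ = (π^{α i} δ_{τ(i) j}) is given by (τ , α).
record Monomial (n : ℕ) : Set where
  constructor mono
  field
    τ : Permutation′ n
    α : Fin n → ℤ

monoType : ∀ {n} → Monomial n → ℤ
monoType ξ = sumℤ (Monomial.α ξ)

-- exponent matrix of ξ Γ ξ⁻¹: (ξΓξ⁻¹)_{ij} = π^{α i} 𝔭^{μ τi τj} π^{-α j}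
--                                       = 𝔭^{μ τi τj + α i - α j}
conj : ∀ {n} → Monomial n → ExpMat n → ExpMat n
conj (mono τ α) μ i j = μ (τ ⟨$⟩ʳ i) (τ ⟨$⟩ʳ j) + α i - α j

InNormalizer : ∀ {n} → Monomial n → ExpMat n → Set
InNormalizer ξ μ = ∀ i j → conj ξ μ i j ≡ μ i j

SameClass : ∀ {n} → (Fin n → Fin n → Fin n → ℤ) → (Fin n → ℤ)
                  → (Fin n → Fin n → Fin n → ℤ) → (Fin n → ℤ) → Set
SameClass {n} m t m' t' =
  Σ (Permutation′ n) λ σ →
    (∀ i j l → m' i j l ≡ m (σ ⟨$⟩ʳ i) (σ ⟨$⟩ʳ j) (σ ⟨$⟩ʳ l))
    × (∀ i → t' i ≡[mod n ] t (σ ⟨$⟩ʳ i))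

_∼_ : ∀ {n} → ExpMat n → ExpMat n → Set
μ ∼ μ' = SameClass (inv μ) (types μ) (inv μ') (types μ')

ξdiag : ∀ {n} → ℤ → Fin n → ℤ
ξdiag s zero = s
ξdiag s (suc _) = + 0

open import Data.Fin.Permutation using (id)

ξs : ∀ {n} → ℤ → Monomial n
ξs s = mono id (ξdiag s)

Γ[_] : ∀ {n} → ExpMat n → ℤ → ExpMat n
Γ[ μ ] s = conj (ξs s) μ

-- Conjugating Γ by a monomial ξ = (τ, α) permutes the structural invariants by τ and adds
-- the type of ξ to every type of a distinguished vertex (mod n).  Hence the shifts c for which
-- [(m),(t)] = [(m),(t + c)] form a subgroup of ℤ, closed under integer multiples.  A normalizing
-- ξ puts t(ξ) into this subgroup, and since Γ_s has invariants (m) and types t + s, the relation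
-- Γ_s ∼ Γ_{s+r} says exactly that r lies in it.
module Submission where

open import Defs
open import Data.Nat using (ℕ; zero; suc)
import Data.Nat.Divisibility as ℕ
open import Data.Fin using (Fin; zero; suc)
open import Data.Fin.Permutation as Perm using (Permutation′; _⟨$⟩ʳ_; _⟨$⟩ˡ_; _∘ₚ_; flip; inverseʳ)
open import Data.Integer using (ℤ; +_; -[1+_]; _+_; _-_; _*_; -_)
open import Data.Integer.Divisibility using (_∣_)
import Data.Integer.Divisibility.Signed as Signed
import Data.Integer.Properties as ℤ
open import Data.Integer.Tactic.RingSolver using (solve-∀)
open import Data.Product using (_×_; _,_)
open import Function using (_⇔_; mk⇔; Equivalence)
open import Relation.Binary.PropositionalEquality
open import Relation.Binary.Bundles using (Setoid)
import Relation.Binary.Reasoning.Setoid as SetoidReasoning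
open import Level using (0ℓ)
open import Data.Wrap using (Wrap; [_]; get)
import Algebra.Properties.CommutativeMonoid.Sum ℤ.+-0-commutativeMonoid as Sum

module _ {n : ℕ} where

  ≡[mod]-reflexive : ∀ {a b} → a ≡ b → a ≡[mod n ] b
  ≡[mod]-reflexive {a} refl = subst (λ d → + n ∣ d) (sym (ℤ.+-inverseʳ a)) (n ℕ.∣0)

  ≡[mod]-sym : ∀ a b → a ≡[mod n ] b → b ≡[mod n ] a
  ≡[mod]-sym a b = subst (n ℕ.∣_) (ℤ.∣i-j∣≡∣j-i∣ a b)

  ≡[mod]-trans : ∀ a b c → a ≡[mod n ] b → b ≡[mod n ] c → a ≡[mod n ] c
  ≡[mod]-trans a b c p q = Signed.∣⇒∣ᵤ
    (subst (+ n Signed.∣_) (ℤ.+-minus-telescope a b c)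
      (Signed.∣m∣n⇒∣m+n (Signed.∣ᵤ⇒∣ {+ n} {a - b} p) (Signed.∣ᵤ⇒∣ {+ n} {b - c} q)))

  ≡[mod]-+-congʳ : ∀ a b c → a ≡[mod n ] b → (a + c) ≡[mod n ] (b + c)
  ≡[mod]-+-congʳ a b c = subst (λ d → + n ∣ d) (sym (cancel a b c))
    where
    cancel : ∀ a b c → (a + c) - (b + c) ≡ a - b
    cancel = solve-∀

  ≡[mod]-minus-multiple : ∀ a k → (a - + n * k) ≡[mod n ] a
  ≡[mod]-minus-multiple a k = Signed.∣⇒∣ᵤ (Signed.divides (- k) (difference a k (+ n)))
    where
    difference : ∀ a k n → (a - n * k) - a ≡ (- k) * n
    difference = solve-∀

sumℤ≡sum : ∀ {n} (f : Fin n → ℤ) → sumℤ f ≡ Sum.sum f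
sumℤ≡sum {zero}  f = refl
sumℤ≡sum {suc n} f = cong (λ s → f zero + s) (sumℤ≡sum (λ i → f (suc i)))

sumℤ-cong : ∀ {n} {f g : Fin n → ℤ} → (∀ i → f i ≡ g i) → sumℤ f ≡ sumℤ g
sumℤ-cong {f = f} {g} f≗g =
  trans (sumℤ≡sum f) (trans (Sum.sum-cong-≗ f≗g) (sym (sumℤ≡sum g)))

sumℤ-permute : ∀ {n} (f : Fin n → ℤ) (π : Permutation′ n) → sumℤ (λ i → f (π ⟨$⟩ʳ i)) ≡ sumℤ f
sumℤ-permute f π = trans (sumℤ≡sum (λ i → f (π ⟨$⟩ʳ i)))
  (trans (sym (Sum.sum-permute f π)) (sym (sumℤ≡sum f)))

sumℤ-+-minus-const : ∀ {n} (f g : Fin n → ℤ) c →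
                     sumℤ (λ i → f i + g i - c) ≡ sumℤ f + sumℤ g - + n * c
sumℤ-+-minus-const {zero}  f g c = identity c
  where
  identity : ∀ c → + 0 ≡ + 0 + + 0 - + 0 * c
  identity = solve-∀
sumℤ-+-minus-const {suc n} f g c =
  trans (cong (λ s → f zero + g zero - c + s) (sumℤ-+-minus-const (λ i → f (suc i)) (λ i → g (suc i)) c))
        (regroup (f zero) (g zero) c (sumℤ (λ i → f (suc i))) (sumℤ (λ i → g (suc i))) (+ n))
  where
  regroup : ∀ a b c x y k → (a + b - c) + (x + y - k * c) ≡ (a + x) + (b + y) - (+ 1 + k) * c
  regroup = solve-∀

sumℤ-zero : ∀ n → sumℤ {n} (λ _ → + 0) ≡ + 0
sumℤ-zero n = trans (sumℤ≡sum {n} (λ _ → + 0)) (Sum.sum-replicate-zero n)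

module _ {n : ℕ} where

  Invariants : Set
  Invariants = (Fin n → Fin n → Fin n → ℤ) × (Fin n → ℤ)

  SameClassᵢ : Invariants → Invariants → Set
  SameClassᵢ (m , t) (m′ , t′) = SameClass m t m′ t′

  -- Wrapping makes _≋_ injective, so that its endpoints can be inferred.
  infix 4 _≋_
  _≋_ : Invariants → Invariants → Set
  _≋_ = Wrap SameClassᵢ

  ≋-pointwise : ∀ {m m′ t t′} → (∀ i j l → m′ i j l ≡ m i j l) → (∀ i → t′ i ≡ t i) →
                (m , t) ≋ (m′ , t′)
  ≋-pointwise {t = t} {t′} m′≗m t′≗t =
    [ Perm.id , m′≗m , (λ i → ≡[mod]-reflexive {n} {t′ i} {t i} (t′≗t i)) ]

  ≋-refl : ∀ {x} → x ≋ x
  ≋-refl = ≋-pointwise (λ _ _ _ → refl) (λ _ → refl)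

  ≋-sym : ∀ {x y} → x ≋ y → y ≋ x
  ≋-sym {m , t} {m′ , t′} [ σ , m′≡mσ , t′≈tσ ] = [ flip σ , mσ⁻¹ , tσ⁻¹ ]
    where
    mσ⁻¹ : ∀ i j l → m i j l ≡ m′ (σ ⟨$⟩ˡ i) (σ ⟨$⟩ˡ j) (σ ⟨$⟩ˡ l)
    mσ⁻¹ i j l with m′≡mσ (σ ⟨$⟩ˡ i) (σ ⟨$⟩ˡ j) (σ ⟨$⟩ˡ l)
    ... | eq rewrite inverseʳ σ {i} | inverseʳ σ {j} | inverseʳ σ {l} = sym eq
    tσ⁻¹ : ∀ i → t i ≡[mod n ] t′ (σ ⟨$⟩ˡ i)
    tσ⁻¹ i with t′≈tσ (σ ⟨$⟩ˡ i)
    ... | eq rewrite inverseʳ σ {i} = ≡[mod]-sym (t′ (σ ⟨$⟩ˡ i)) (t i) eq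

  ≋-trans : ∀ {x y z} → x ≋ y → y ≋ z → x ≋ z
  ≋-trans {m , t} {m′ , t′} {m″ , t″} [ σ , m′≡mσ , t′≈tσ ] [ ρ , m″≡m′ρ , t″≈t′ρ ] = [
    ρ ∘ₚ σ ,
    (λ i j l → trans (m″≡m′ρ i j l) (m′≡mσ (ρ ⟨$⟩ʳ i) (ρ ⟨$⟩ʳ j) (ρ ⟨$⟩ʳ l))) ,
    (λ i → ≡[mod]-trans (t″ i) (t′ (ρ ⟨$⟩ʳ i)) (t (σ ⟨$⟩ʳ (ρ ⟨$⟩ʳ i)))
                        (t″≈t′ρ i) (t′≈tσ (ρ ⟨$⟩ʳ i))) ]

  ≋-setoid : Setoid 0ℓ 0ℓ
  ≋-setoid = record
    { _≈_ = _≋_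
    ; isEquivalence = record { refl = ≋-refl ; sym = ≋-sym ; trans = ≋-trans }
    }

  shift : ℤ → Invariants → Invariants
  shift c (m , t) = m , λ i → t i + c

  shift-cong : ∀ c {x y} → x ≋ y → shift c x ≋ shift c y
  shift-cong c {m , t} {m′ , t′} [ σ , m′≡mσ , t′≈tσ ] =
    [ σ , m′≡mσ , (λ i → ≡[mod]-+-congʳ (t′ i) (t (σ ⟨$⟩ʳ i)) c (t′≈tσ i)) ]

  Period : Invariants → ℤ → Set
  Period x c = x ≋ shift c x

  module _ (m : Fin n → Fin n → Fin n → ℤ) (t : Fin n → ℤ) where
    open SetoidReasoning ≋-setoid

    private
      x : Invariants
      x = m , t

      shift-shift : ∀ a b → shift b (shift a x) ≋ shift (a + b) x
      shift-shift a b = ≋-pointwise (λ _ _ _ → refl) (λ i → sym (ℤ.+-assoc (t i) a b))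

      shift-zero : shift (+ 0) x ≋ x
      shift-zero = ≋-pointwise (λ _ _ _ → refl) (λ i → sym (ℤ.+-identityʳ (t i)))

      shift-neg : ∀ a → shift (- a) (shift a x) ≋ x
      shift-neg a = begin
        shift (- a) (shift a x) ≈⟨ shift-shift a (- a) ⟩
        shift (a - a) x         ≡⟨ cong (λ c → shift c x) (ℤ.+-inverseʳ a) ⟩
        shift (+ 0) x           ≈⟨ shift-zero ⟩
        x                       ∎

    period-zero : Period x (+ 0)
    period-zero = ≋-sym shift-zero

    period-+ : ∀ {a b} → Period x a → Period x b → Period x (a + b)
    period-+ {a} {b} pa pb = begin
      x                       ≈⟨ pa ⟩
      shift a x               ≈⟨ shift-cong a pb ⟩
      shift a (shift b x)     ≈⟨ shift-shift b a ⟩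
      shift (b + a) x         ≡⟨ cong (λ c → shift c x) (ℤ.+-comm b a) ⟩
      shift (a + b) x         ∎

    period-neg : ∀ {a} → Period x a → Period x (- a)
    period-neg {a} pa = begin
      x                       ≈⟨ shift-neg a ⟨
      shift (- a) (shift a x) ≈⟨ shift-cong (- a) pa ⟨
      shift (- a) x           ∎

    period-*ℕ : ∀ {c} k → Period x c → Period x (+ k * c)
    period-*ℕ {c} zero    _  = subst (Period x) (sym (ℤ.*-zeroˡ c)) period-zero
    period-*ℕ {c} (suc k) pc = subst (Period x) (sym (ℤ.suc-* (+ k) c)) (period-+ pc (period-*ℕ k pc))

    period-* : ∀ {c} l → Period x c → Period x (l * c)
    period-* (+ k)        pc = period-*ℕ k pc
    period-* {c} -[1+ k ] pc =
      subst (Period x) (ℤ.neg-distribˡ-* (+ suc k) c) (period-neg (period-*ℕ (suc k) pc))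

    period⇔shifts-≋ : ∀ a c → Period x c ⇔ shift a x ≋ shift (a + c) x
    period⇔shifts-≋ a c = mk⇔ to from
      where
      to : Period x c → shift a x ≋ shift (a + c) x
      to pc = begin
        shift a x           ≈⟨ shift-cong a pc ⟩
        shift a (shift c x) ≈⟨ shift-shift c a ⟩
        shift (c + a) x     ≡⟨ cong (λ d → shift d x) (ℤ.+-comm c a) ⟩
        shift (a + c) x     ∎
      from : shift a x ≋ shift (a + c) x → Period x c
      from p = begin
        x                               ≈⟨ shift-neg a ⟨
        shift (- a) (shift a x)         ≈⟨ shift-cong (- a) p ⟩
        shift (- a) (shift (a + c) x)   ≈⟨ shift-shift (a + c) (- a) ⟩
        shift (a + c - a) x             ≡⟨ cong (λ d → shift d x) (cancel a c) ⟩
        shift c x                       ∎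
        where
        cancel : ∀ a c → a + c - a ≡ c
        cancel = solve-∀

invariants : ∀ {n} → ExpMat n → Invariants
invariants μ = inv μ , types μ

-- The Fin n argument only witnesses n ≥ 1; for n = 0 the sum is 0.
sumℤ-ξdiag : ∀ {n} s → Fin n → sumℤ (ξdiag {n} s) ≡ s
sumℤ-ξdiag {suc n} s _ = trans (cong (λ z → s + z) (sumℤ-zero n)) (ℤ.+-identityʳ s)

module _ {n : ℕ} (μ : ExpMat n) where
  open SetoidReasoning (≋-setoid {n})

  inv-conj : ∀ τ α i j l → inv (conj (mono τ α) μ) i j l ≡ inv μ (τ ⟨$⟩ʳ i) (τ ⟨$⟩ʳ j) (τ ⟨$⟩ʳ l)
  inv-conj τ α i j l =
    cancel (μ (τ ⟨$⟩ʳ i) (τ ⟨$⟩ʳ j)) (μ (τ ⟨$⟩ʳ j) (τ ⟨$⟩ʳ l)) (μ (τ ⟨$⟩ʳ i) (τ ⟨$⟩ʳ l)) (α i) (α j) (α l)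
    where
    cancel : ∀ a b c x y z → (a + x - y) + (b + y - z) - (c + x - z) ≡ a + b - c
    cancel = solve-∀

  types-conj : ∀ τ α j → types (conj (mono τ α) μ) j ≡[mod n ] (types μ (τ ⟨$⟩ʳ j) + sumℤ α)
  types-conj τ α j = ≡[mod]-trans (types (conj (mono τ α) μ) j) (T + sumℤ α - + n * α j) (T + sumℤ α)
    (≡[mod]-reflexive {n} types-eq) (≡[mod]-minus-multiple (T + sumℤ α) (α j))
    where
    T : ℤ
    T = types μ (τ ⟨$⟩ʳ j)
    types-eq : types (conj (mono τ α) μ) j ≡ T + sumℤ α - + n * α j
    types-eq = trans (sumℤ-+-minus-const (λ i → μ (τ ⟨$⟩ʳ i) (τ ⟨$⟩ʳ j)) α (α j))
      (cong (λ z → z + sumℤ α - + n * α j) (sumℤ-permute (λ i → μ i (τ ⟨$⟩ʳ j)) τ))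

  conj-≋ : (ξ : Monomial n) → shift (monoType ξ) (invariants μ) ≋ invariants (conj ξ μ)
  conj-≋ (mono τ α) = [ τ , inv-conj τ α , types-conj τ α ]

  ≗⇒≋ : {ν : ExpMat n} → (∀ i j → ν i j ≡ μ i j) → invariants μ ≋ invariants ν
  ≗⇒≋ ν≗μ = ≋-pointwise
    (λ i j l → cong₂ _-_ (cong₂ _+_ (ν≗μ i j) (ν≗μ j l)) (ν≗μ i l))
    (λ j → sumℤ-cong (λ i → ν≗μ i j))

  Γ-≋ : ∀ s → shift s (invariants μ) ≋ invariants (Γ[ μ ] s)
  Γ-≋ s = begin
    shift s (invariants μ)
      ≈⟨ ≋-pointwise (λ _ _ _ → refl) (λ i → cong (λ c → types μ i + c) (sumℤ-ξdiag s i)) ⟩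
    shift (monoType (ξs {n} s)) (invariants μ)
      ≈⟨ conj-≋ (ξs s) ⟩
    invariants (Γ[ μ ] s)
      ∎

  normalizer-type-period : (ξ : Monomial n) → InNormalizer ξ μ → Period (invariants μ) (monoType ξ)
  normalizer-type-period ξ ξμξ⁻¹≡μ = ≋-sym (begin
    shift (monoType ξ) (invariants μ) ≈⟨ conj-≋ ξ ⟩
    invariants (conj ξ μ)             ≈⟨ ≗⇒≋ ξμξ⁻¹≡μ ⟨
    invariants μ                      ∎)

  Γ-∼-multiples : ∀ s r → Γ[ μ ] s ∼ Γ[ μ ] (s + r) → ∀ l → Γ[ μ ] s ∼ Γ[ μ ] (s + l * r)
  Γ-∼-multiples s r Γₛ∼Γₛ₊ᵣ l = get (begin
    invariants (Γ[ μ ] s)            ≈⟨ Γ-≋ s ⟨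
    shift s (invariants μ)           ≈⟨ Equivalence.to (period⇔shifts-≋ (inv μ) (types μ) s (l * r))
                                                       (period-* (inv μ) (types μ) l r-period) ⟩
    shift (s + l * r) (invariants μ) ≈⟨ Γ-≋ (s + l * r) ⟩
    invariants (Γ[ μ ] (s + l * r))  ∎)
    where
    r-period : Period (invariants μ) r
    r-period = Equivalence.from (period⇔shifts-≋ (inv μ) (types μ) s r) (begin
      shift s (invariants μ)       ≈⟨ Γ-≋ s ⟩
      invariants (Γ[ μ ] s)        ≈⟨ [ Γₛ∼Γₛ₊ᵣ ] ⟩
      invariants (Γ[ μ ] (s + r))  ≈⟨ Γ-≋ (s + r) ⟨
      shift (s + r) (invariants μ) ∎)

lemma3p9 : (n : ℕ) (μ : ExpMat n) → IsTiled μ →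
    ((ξ : Monomial n) → InNormalizer ξ μ → (l : ℤ) →
      SameClass (inv μ) (types μ) (inv μ) (λ i → types μ i + l * monoType ξ))
    × ((s r : ℤ) → Γ[ μ ] s ∼ Γ[ μ ] (s + r) → (l : ℤ) → Γ[ μ ] s ∼ Γ[ μ ] (s + l * r))
lemma3p9 n μ _ =
  (λ ξ ξ∈𝒩 l → get (period-* (inv μ) (types μ) l (normalizer-type-period μ ξ ξ∈𝒩))) ,
  Γ-∼-multiples μ
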